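{- Let $G$ be a bipartite graph with vertex partition $(A,B)$ such that every vertex in $B$ has even degree. Then $G$ can be decomposed into at most $3\Delta(G)$ edge-disjoint flocks of seagulls with wings in $A$.
   Context: A seagull is a path of length $2$ (three vertices, two edges); its wings are its two vertices of degree one. A flock of seagulls is a graph that is a vertex-disjoint union of seagulls. "Wings in $A$" means every seagull of the flock has both wings in $A$. $\Delta(G)$ is the maximum degree of $G$. -}

module Defs where

open import Data.Nat using (ℕ; zero; suc; _+_; _⊔_)
open import Data.Bool using (Bool; true; false; if_then_else_)
open import Data.Fin using (Fin)
open import Data.Fin.Properties using (_≟_)
open import Data.List using (List; []; _∷_; map; allFin; filterᵇ; length; foldr; _++_; concat)
open import Data.List.Relation.Unary.AllPairs using (AllPairs)
open import Data.List.Relation.Unary.All using (All)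
open import Data.Product using (_×_)
open import Relation.Binary.PropositionalEquality using (_≡_; _≢_)
open import Relation.Nullary.Decidable using (⌊_⌋)
open import Data.Bool using (_∧_)
open import Data.Nat.ListAction using (sum)

-- A finite simple bipartite graph with vertex partition (A , B),
-- A = Fin a, B = Fin b; adjacency is only between A and B.
BipGraph : ℕ → ℕ → Set
BipGraph a b = Fin a → Fin b → Bool

module _ {a b : ℕ} (G : BipGraph a b) where

  degA : Fin a → ℕ
  degA x = length (filterᵇ (λ y → G x y) (allFin b))

  degB : Fin b → ℕ
  degB y = length (filterᵇ (λ x → G x y) (allFin a))

  Δ : ℕ
  Δ = foldr _⊔_ 0 (map degA (allFin a) ++ map degB (allFin b))

record Seagull (a b : ℕ) : Set where
  constructor seagull
  field
    wing₁ : Fin a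
    centre : Fin b
    wing₂ : Fin a
    wings-distinct : wing₁ ≢ wing₂
open Seagull public

VertexDisjoint : {a b : ℕ} → Seagull a b → Seagull a b → Set
VertexDisjoint s t =
  (centre s ≢ centre t) ×
  (wing₁ s ≢ wing₁ t) × (wing₁ s ≢ wing₂ t) ×
  (wing₂ s ≢ wing₁ t) × (wing₂ s ≢ wing₂ t)

Flock : ℕ → ℕ → Set
Flock a b = List (Seagull a b)

IsFlock : {a b : ℕ} → Flock a b → Set
IsFlock F = AllPairs VertexDisjoint F

SeagullIn : {a b : ℕ} → BipGraph a b → Seagull a b → Set
SeagullIn G s = (G (wing₁ s) (centre s) ≡ true) × (G (wing₂ s) (centre s) ≡ true)

edgeCount : {a b : ℕ} → Fin a → Fin b → Seagull a b → ℕ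
edgeCount x y s =
  (if ⌊ wing₁ s ≟ x ⌋ ∧ ⌊ centre s ≟ y ⌋ then 1 else 0) +
  (if ⌊ wing₂ s ≟ x ⌋ ∧ ⌊ centre s ≟ y ⌋ then 1 else 0)

record Decomposition {a b : ℕ} (G : BipGraph a b) (Fs : List (Flock a b)) : Set where
  field
    flocks    : All IsFlock Fs
    inG       : All (All (SeagullIn G)) Fs
    exactOnce : ∀ x y → G x y ≡ true →
                sum (map (edgeCount x y) (concat Fs)) ≡ 1

module Submission where

-- Pairing up the neighbours of each vertex of B (possible since its degree is even) splits the
-- edges of G into seagulls with wings in A.  These are placed greedily into 3Δ flocks, each
-- seagull s into the first flock containing no seagull that meets s.  If every flock contained
-- such a seagull, each flock would own an already placed edge at one of the three vertices of s.
-- These vertices carry at most 3Δ edges, and at least one of them is an edge of s itself that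
-- has not been placed yet, so there would be fewer than 3Δ flocks.

open import Algebra.Properties.CommutativeSemigroup using (interchange; x∙yz≈y∙xz; xy∙z≈y∙xz)
open import Data.Bool using (Bool; true; false; T?; if_then_else_; _∧_)
open import Data.Bool.Properties using (∧-zeroʳ; T-≡)
open import Data.Empty using (⊥-elim)
open import Data.Fin using (Fin)
open import Data.Fin.Properties using (_≟_)
open import Data.List using (List; []; _∷_; _++_; map; concat; concatMap; length; filterᵇ; foldr; allFin; replicate)
open import Data.List.Membership.Propositional using (_∈_)
open import Data.List.Membership.Propositional.Properties using (∈-allFin; ∈-map⁺; ∈-++⁺ˡ; ∈-++⁺ʳ)
open import Data.List.Properties using (map-++; map-cong; length-replicate)
open import Data.List.Relation.Unary.All as All using (All; []; _∷_; all?)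
open import Data.List.Relation.Unary.All.Properties using (¬All⇒Any¬; all-filter; replicate⁺; map⁺; concat⁺)
open import Data.List.Relation.Unary.AllPairs using ([]; _∷_)
open import Data.List.Relation.Unary.Any using (Any; here; there)
open import Data.List.Relation.Unary.Unique.Propositional using (Unique)
open import Data.List.Relation.Unary.Unique.Propositional.Properties using (allFin⁺; filter⁺)
open import Data.Nat using (ℕ; zero; suc; _+_; _*_; _⊔_; _≤_; _<_; z≤n)
open import Data.Nat.Divisibility using (_∣_; ∣m+n∣m⇒∣n; ∣-refl; ∣⇒≤)
open import Data.Nat.ListAction using (sum)
open import Data.Nat.ListAction.Properties using (sum-++)
open import Data.Nat.Properties
  using (+-assoc; +-identityʳ; *-identityʳ; *-zeroʳ; +-mono-≤; m≤m+n; m≤n+m; m<m+n; m≤m⊔n; m≤n⊔m;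
         ≤-trans; ≤-reflexive; <-irrefl; <⇒≱; +-commutativeSemigroup; module ≤-Reasoning)
open import Data.Product using (Σ; _×_; _,_; proj₁)
open import Data.Sum using (_⊎_; inj₁; inj₂)
open import Function using (_∘_; Equivalence)
open import Relation.Binary.PropositionalEquality using (_≡_; _≢_; refl; sym; trans; cong; cong₂; module ≡-Reasoning)
open import Relation.Nullary using (¬_; Dec; yes; no)
open import Relation.Nullary.Decidable using (⌊_⌋; isYes≗does; dec-true; dec-false; ¬?; _×-dec_)

open import Defs

private
  variable
    A : Set
    x : A
    xs ys : List A
    f g : A → ℕ

∑ : List A → (A → ℕ) → ℕ
∑ xs f = sum (map f xs)

syntax ∑ xs (λ x → e) = ∑[ x ∈ xs ] e

indicator : Bool → ℕ
indicator b = if b then 1 else 0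

∑-cong : ∀ xs → (∀ x → f x ≡ g x) → ∑ xs f ≡ ∑ xs g
∑-cong xs f≗g = cong sum (map-cong f≗g xs)

∑-++ : ∀ xs → ∑ (xs ++ ys) f ≡ ∑ xs f + ∑ ys f
∑-++ {ys = ys} {f = f} xs = trans (cong sum (map-++ f xs ys)) (sum-++ (map f xs) (map f ys))

∑-concatMap : {B : Set} {h : B → List A} (bs : List B) → ∑ (concatMap h bs) f ≡ ∑[ b ∈ bs ] ∑ (h b) f
∑-concatMap [] = refl
∑-concatMap {h = h} (b ∷ bs) = trans (∑-++ (h b)) (cong (∑ (h b) _ +_) (∑-concatMap bs))

∑-+ : ∀ xs → ∑[ x ∈ xs ] (f x + g x) ≡ ∑ xs f + ∑ xs g
∑-+ [] = refl
∑-+ {f = f} {g = g} (x ∷ xs) =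
  trans (cong (f x + g x +_) (∑-+ xs)) (interchange +-commutativeSemigroup (f x) (g x) _ _)

∑-∈ : x ∈ xs → f x ≤ ∑ xs f
∑-∈ {xs = x ∷ xs} {f = f} (here refl) = m≤m+n (f x) (∑ xs f)
∑-∈ {xs = y ∷ xs} {f = f} (there x∈xs) = ≤-trans (∑-∈ x∈xs) (m≤n+m (∑ xs f) (f y))

∑-zero : All (λ x → f x ≡ 0) xs → ∑ xs f ≡ 0
∑-zero [] = refl
∑-zero (fx≡0 ∷ zeros) = cong₂ _+_ fx≡0 (∑-zero zeros)

∑-unique-support : {i : A} → Unique xs → i ∈ xs → (∀ j → j ≢ i → f j ≡ 0) → ∑ xs f ≡ f i
∑-unique-support {f = f} {i = i} (i∉xs ∷ _) (here refl) vanish =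
  trans (cong (f i +_) (∑-zero (All.map (λ i≢j → vanish _ (i≢j ∘ sym)) i∉xs))) (+-identityʳ (f i))
∑-unique-support (j∉xs ∷ unique) (there i∈xs) vanish =
  cong₂ _+_ (vanish _ (All.lookup j∉xs i∈xs)) (∑-unique-support unique i∈xs vanish)

∑-filterᵇ : (p : A → Bool) (xs : List A) → ∑ (filterᵇ p xs) f ≡ ∑[ x ∈ xs ] (indicator (p x) * f x)
∑-filterᵇ p [] = refl
∑-filterᵇ {f = f} p (x ∷ xs) with p x
... | true  = cong₂ _+_ (sym (+-identityʳ (f x))) (∑-filterᵇ p xs)
... | false = ∑-filterᵇ p xs

length-filterᵇ : (p : A → Bool) (xs : List A) → length (filterᵇ p xs) ≡ ∑[ x ∈ xs ] indicator (p x)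
length-filterᵇ p [] = refl
length-filterᵇ p (x ∷ xs) with p x
... | true  = cong suc (length-filterᵇ p xs)
... | false = length-filterᵇ p xs

≤-foldr-⊔ : {n : ℕ} {ns : List ℕ} → n ∈ ns → n ≤ foldr _⊔_ 0 ns
≤-foldr-⊔ (here refl) = m≤m⊔n _ _
≤-foldr-⊔ {ns = m ∷ _} (there n∈ns) = ≤-trans (≤-foldr-⊔ n∈ns) (m≤n⊔m m _)

2∤1 : ¬ (2 ∣ 1)
2∤1 2∣1 = <-irrefl refl (∣⇒≤ 2∣1)

EdgeWeights : ℕ → ℕ → Set
EdgeWeights a b = Fin a → Fin b → ℕ

module _ {a b : ℕ} where

  edges : BipGraph a b → EdgeWeights a b
  edges G x y = indicator (G x y)

  edgesOf : Seagull a b → EdgeWeights a b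
  edgesOf t x y = edgeCount x y t

  multiplicity : List (Seagull a b) → EdgeWeights a b
  multiplicity L x y = ∑ L (edgeCount x y)

  multiplicity-++ : (L : List (Seagull a b)) {M : List (Seagull a b)} {x : Fin a} {y : Fin b} →
    multiplicity (L ++ M) x y ≡ multiplicity L x y + multiplicity M x y
  multiplicity-++ L = ∑-++ L

  degreeA : EdgeWeights a b → Fin a → ℕ
  degreeA m x = ∑[ y ∈ allFin b ] m x y

  degreeB : EdgeWeights a b → Fin b → ℕ
  degreeB m y = ∑[ x ∈ allFin a ] m x y

  degA≡degreeA-edges : (G : BipGraph a b) (x : Fin a) → degA G x ≡ degreeA (edges G) x
  degA≡degreeA-edges G x = length-filterᵇ (G x) (allFin b)

  degB≡degreeB-edges : (G : BipGraph a b) (y : Fin b) → degB G y ≡ degreeB (edges G) y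
  degB≡degreeB-edges G y = length-filterᵇ (λ x → G x y) (allFin a)

  degA≤Δ : (G : BipGraph a b) (x : Fin a) → degA G x ≤ Δ G
  degA≤Δ G x = ≤-foldr-⊔ (∈-++⁺ˡ (∈-map⁺ (degA G) (∈-allFin x)))

  degB≤Δ : (G : BipGraph a b) (y : Fin b) → degB G y ≤ Δ G
  degB≤Δ G y = ≤-foldr-⊔ (∈-++⁺ʳ (map (degA G) (allFin a)) (∈-map⁺ (degB G) (∈-allFin y)))

  incidence : Seagull a b → EdgeWeights a b → ℕ
  incidence s m = degreeB m (centre s) + (degreeA m (wing₁ s) + degreeA m (wing₂ s))

  incidence-cong : (s : Seagull a b) {m n : EdgeWeights a b} →
    (∀ x y → m x y ≡ n x y) → incidence s m ≡ incidence s n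
  incidence-cong s m≗n =
    cong₂ _+_ (∑-cong (allFin a) (λ x → m≗n x _))
              (cong₂ _+_ (∑-cong (allFin b) (m≗n _)) (∑-cong (allFin b) (m≗n _)))

  incidence-+ : (s : Seagull a b) (m n : EdgeWeights a b) →
    incidence s (λ x y → m x y + n x y) ≡ incidence s m + incidence s n
  incidence-+ s m n = begin
    incidence s (λ x y → m x y + n x y)
      ≡⟨ cong₂ _+_ (∑-+ (allFin a)) (cong₂ _+_ (∑-+ (allFin b)) (∑-+ (allFin b))) ⟩
    (Bm + Bn) + ((A₁m + A₁n) + (A₂m + A₂n))
      ≡⟨ cong ((Bm + Bn) +_) (interchange +-commutativeSemigroup A₁m A₁n A₂m A₂n) ⟩
    (Bm + Bn) + ((A₁m + A₂m) + (A₁n + A₂n))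
      ≡⟨ interchange +-commutativeSemigroup Bm Bn _ _ ⟩
    incidence s m + incidence s n ∎
    where
    open ≡-Reasoning
    Bm = degreeB m (centre s)
    Bn = degreeB n (centre s)
    A₁m = degreeA m (wing₁ s)
    A₁n = degreeA n (wing₁ s)
    A₂m = degreeA m (wing₂ s)
    A₂n = degreeA n (wing₂ s)

  incidence-edges≤3Δ : (G : BipGraph a b) (s : Seagull a b) → incidence s (edges G) ≤ 3 * Δ G
  incidence-edges≤3Δ G s = begin
    incidence s (edges G)
      ≡⟨ cong₂ _+_ (degB≡degreeB-edges G _) (cong₂ _+_ (degA≡degreeA-edges G _) (degA≡degreeA-edges G _)) ⟨
    degB G (centre s) + (degA G (wing₁ s) + degA G (wing₂ s))
      ≤⟨ +-mono-≤ (degB≤Δ G _) (+-mono-≤ (degA≤Δ G _) (degA≤Δ G _)) ⟩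
    Δ G + (Δ G + Δ G)
      ≡⟨ cong (λ n → Δ G + (Δ G + n)) (+-identityʳ (Δ G)) ⟨
    3 * Δ G ∎
    where open ≤-Reasoning

  ≤-incidence-centre : (s : Seagull a b) (m : EdgeWeights a b) {x : Fin a} {y : Fin b} →
    centre s ≡ y → m x y ≤ incidence s m
  ≤-incidence-centre s m {x} refl = ≤-trans (∑-∈ {f = λ x′ → m x′ (centre s)} (∈-allFin x)) (m≤m+n _ _)

  ≤-incidence-wing₁ : (s : Seagull a b) (m : EdgeWeights a b) {x : Fin a} {y : Fin b} →
    wing₁ s ≡ x → m x y ≤ incidence s m
  ≤-incidence-wing₁ s m {y = y} refl = ≤-trans (∑-∈ {f = m (wing₁ s)} (∈-allFin y))
    (≤-trans (m≤m+n _ (degreeA m (wing₂ s))) (m≤n+m _ (degreeB m (centre s))))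

  ≤-incidence-wing₂ : (s : Seagull a b) (m : EdgeWeights a b) {x : Fin a} {y : Fin b} →
    wing₂ s ≡ x → m x y ≤ incidence s m
  ≤-incidence-wing₂ s m {y = y} refl = ≤-trans (∑-∈ {f = m (wing₂ s)} (∈-allFin y))
    (≤-trans (m≤n+m _ (degreeA m (wing₁ s))) (m≤n+m _ (degreeB m (centre s))))

  sameEdge : Fin a → Fin b → Fin a → Fin b → ℕ
  sameEdge x y w c = indicator (⌊ w ≟ x ⌋ ∧ ⌊ c ≟ y ⌋)

  sameEdge-refl : (x : Fin a) (y : Fin b) → sameEdge x y x y ≡ 1
  sameEdge-refl x y rewrite isYes≗does (x ≟ x) | isYes≗does (y ≟ y) | dec-true (x ≟ x) refl | dec-true (y ≟ y) refl = refl

  sameEdge-≢ˡ : {x w : Fin a} {y c : Fin b} → w ≢ x → sameEdge x y w c ≡ 0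
  sameEdge-≢ˡ {x} {w} w≢x rewrite isYes≗does (w ≟ x) | dec-false (w ≟ x) w≢x = refl

  sameEdge-≢ʳ : {x w : Fin a} {y c : Fin b} → c ≢ y → sameEdge x y w c ≡ 0
  sameEdge-≢ʳ {x} {w} {y} {c} c≢y rewrite isYes≗does (c ≟ y) | dec-false (c ≟ y) c≢y | ∧-zeroʳ ⌊ w ≟ x ⌋ = refl

  wing₁-edge : (t : Seagull a b) → 1 ≤ edgeCount (wing₁ t) (centre t) t
  wing₁-edge t = ≤-trans (≤-reflexive (sym (sameEdge-refl (wing₁ t) (centre t)))) (m≤m+n _ _)

  wing₂-edge : (t : Seagull a b) → 1 ≤ edgeCount (wing₂ t) (centre t) t
  wing₂-edge t = ≤-trans (≤-reflexive (sym (sameEdge-refl (wing₂ t) (centre t)))) (m≤n+m _ _)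

  -- An odd neighbour left over at the end is dropped; evenness of the degrees rules this out.
  pairUp : Fin b → (ws : List (Fin a)) → Unique ws → List (Seagull a b)
  pairUp c [] _ = []
  pairUp c (_ ∷ []) _ = []
  pairUp c (w₁ ∷ w₂ ∷ ws) ((w₁≢w₂ ∷ _) ∷ (_ ∷ unique)) = seagull w₁ c w₂ w₁≢w₂ ∷ pairUp c ws unique

  multiplicity-pairUp : (c : Fin b) (ws : List (Fin a)) (unique : Unique ws) → 2 ∣ length ws →
    ∀ x y → multiplicity (pairUp c ws unique) x y ≡ ∑[ w ∈ ws ] sameEdge x y w c
  multiplicity-pairUp c [] _ _ x y = refl
  multiplicity-pairUp c (_ ∷ []) _ 2∣1 x y = ⊥-elim (2∤1 2∣1)
  multiplicity-pairUp c (w₁ ∷ w₂ ∷ ws) ((_ ∷ _) ∷ (_ ∷ unique)) 2∣2+n x y =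
    trans (+-assoc (sameEdge x y w₁ c) _ _)
          (cong (λ n → sameEdge x y w₁ c + (sameEdge x y w₂ c + n))
                (multiplicity-pairUp c ws unique (∣m+n∣m⇒∣n 2∣2+n ∣-refl) x y))

  pairUp-SeagullIn : (G : BipGraph a b) (c : Fin b) (ws : List (Fin a)) (unique : Unique ws) →
    All (λ w → G w c ≡ true) ws → All (SeagullIn G) (pairUp c ws unique)
  pairUp-SeagullIn G c [] _ _ = []
  pairUp-SeagullIn G c (_ ∷ []) _ _ = []
  pairUp-SeagullIn G c (w₁ ∷ w₂ ∷ ws) ((_ ∷ _) ∷ (_ ∷ unique)) (G₁ ∷ G₂ ∷ Gs) =
    (G₁ , G₂) ∷ pairUp-SeagullIn G c ws unique Gs

  neighbours : BipGraph a b → Fin b → List (Fin a)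
  neighbours G c = filterᵇ (λ w → G w c) (allFin a)

  neighbours-unique : (G : BipGraph a b) (c : Fin b) → Unique (neighbours G c)
  neighbours-unique G c = filter⁺ (T? ∘ λ w → G w c) (allFin⁺ a)

  neighbours-adjacent : (G : BipGraph a b) (c : Fin b) → All (λ w → G w c ≡ true) (neighbours G c)
  neighbours-adjacent G c = All.map (Equivalence.to T-≡) (all-filter (T? ∘ λ w → G w c) (allFin a))

  seagulls : BipGraph a b → List (Seagull a b)
  seagulls G = concatMap (λ c → pairUp c (neighbours G c) (neighbours-unique G c)) (allFin b)

  seagulls-SeagullIn : (G : BipGraph a b) → All (SeagullIn G) (seagulls G)
  seagulls-SeagullIn G = concat⁺ (map⁺ (All.universal
    (λ c → pairUp-SeagullIn G c (neighbours G c) (neighbours-unique G c) (neighbours-adjacent G c)) (allFin b)))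

  multiplicity-seagulls : (G : BipGraph a b) → (∀ c → 2 ∣ degB G c) →
    ∀ x y → multiplicity (seagulls G) x y ≡ edges G x y
  multiplicity-seagulls G even x y = begin
    multiplicity (seagulls G) x y
      ≡⟨ ∑-concatMap (allFin b) ⟩
    ∑[ c ∈ allFin b ] multiplicity (pairUp c (neighbours G c) (neighbours-unique G c)) x y
      ≡⟨ ∑-cong (allFin b) (λ c → multiplicity-pairUp c (neighbours G c) (neighbours-unique G c) (even c) x y) ⟩
    ∑[ c ∈ allFin b ] ∑[ w ∈ neighbours G c ] sameEdge x y w c
      ≡⟨ ∑-cong (allFin b) (λ c → ∑-filterᵇ (λ w → G w c) (allFin a)) ⟩
    ∑[ c ∈ allFin b ] ∑[ w ∈ allFin a ] (indicator (G w c) * sameEdge x y w c)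
      ≡⟨ ∑-unique-support (allFin⁺ b) (∈-allFin y) (λ c c≢y → ∑-zero (All.universal (off-row c≢y) (allFin a))) ⟩
    ∑[ w ∈ allFin a ] (indicator (G w y) * sameEdge x y w y)
      ≡⟨ ∑-unique-support (allFin⁺ a) (∈-allFin x) (λ w w≢x → weight-zero w y (sameEdge-≢ˡ w≢x)) ⟩
    indicator (G x y) * sameEdge x y x y
      ≡⟨ trans (cong (indicator (G x y) *_) (sameEdge-refl x y)) (*-identityʳ (indicator (G x y))) ⟩
    edges G x y ∎
    where
    open ≡-Reasoning
    weight-zero : ∀ w c → sameEdge x y w c ≡ 0 → indicator (G w c) * sameEdge x y w c ≡ 0
    weight-zero w c e = trans (cong (indicator (G w c) *_) e) (*-zeroʳ (indicator (G w c)))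
    off-row : ∀ {c} → c ≢ y → ∀ w → indicator (G w c) * sameEdge x y w c ≡ 0
    off-row {c} c≢y w = weight-zero w c (sameEdge-≢ʳ c≢y)

  vertexDisjoint? : (s t : Seagull a b) → Dec (VertexDisjoint s t)
  vertexDisjoint? s t =
    ¬? (centre s ≟ centre t) ×-dec ¬? (wing₁ s ≟ wing₁ t) ×-dec ¬? (wing₁ s ≟ wing₂ t) ×-dec
    ¬? (wing₂ s ≟ wing₁ t) ×-dec ¬? (wing₂ s ≟ wing₂ t)

  clash⇒incidence : (s t : Seagull a b) → ¬ VertexDisjoint s t → 1 ≤ incidence s (edgesOf t)
  clash⇒incidence s t clash
    with centre s ≟ centre t | wing₁ s ≟ wing₁ t | wing₁ s ≟ wing₂ t | wing₂ s ≟ wing₁ t | wing₂ s ≟ wing₂ t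
  ... | yes e | _ | _ | _ | _ = ≤-trans (wing₁-edge t) (≤-incidence-centre s (edgesOf t) e)
  ... | no _ | yes e | _ | _ | _ = ≤-trans (wing₁-edge t) (≤-incidence-wing₁ s (edgesOf t) e)
  ... | no _ | no _ | yes e | _ | _ = ≤-trans (wing₂-edge t) (≤-incidence-wing₁ s (edgesOf t) e)
  ... | no _ | no _ | no _ | yes e | _ = ≤-trans (wing₁-edge t) (≤-incidence-wing₂ s (edgesOf t) e)
  ... | no _ | no _ | no _ | no _ | yes e = ≤-trans (wing₂-edge t) (≤-incidence-wing₂ s (edgesOf t) e)
  ... | no c≢c | no ≢₁₁ | no ≢₁₂ | no ≢₂₁ | no ≢₂₂ = ⊥-elim (clash (c≢c , ≢₁₁ , ≢₁₂ , ≢₂₁ , ≢₂₂))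

  Clashes : Seagull a b → Flock a b → Set
  Clashes s F = Any (λ t → ¬ VertexDisjoint s t) F

  clashes⇒incidence : (s : Seagull a b) {F : Flock a b} → Clashes s F → 1 ≤ incidence s (multiplicity F)
  clashes⇒incidence s {t ∷ F} (here clash) =
    ≤-trans (clash⇒incidence s t clash)
            (≤-trans (m≤m+n _ (incidence s (multiplicity F))) (≤-reflexive (sym (incidence-+ s (edgesOf t) (multiplicity F)))))
  clashes⇒incidence s {t ∷ F} (there clashes) =
    ≤-trans (clashes⇒incidence s clashes)
            (≤-trans (m≤n+m _ (incidence s (edgesOf t))) (≤-reflexive (sym (incidence-+ s (edgesOf t) (multiplicity F)))))

  incidence-++ : (s : Seagull a b) (L : List (Seagull a b)) {M : List (Seagull a b)} →
    incidence s (multiplicity (L ++ M)) ≡ incidence s (multiplicity L) + incidence s (multiplicity M)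
  incidence-++ s L {M} = trans (incidence-cong s (λ x y → multiplicity-++ L)) (incidence-+ s (multiplicity L) (multiplicity M))

  blocked⇒length≤incidence : (s : Seagull a b) {Fs : List (Flock a b)} →
    All (Clashes s) Fs → length Fs ≤ incidence s (multiplicity (concat Fs))
  blocked⇒length≤incidence s [] = z≤n
  blocked⇒length≤incidence s {F ∷ _} (clashes ∷ blocked) =
    ≤-trans (+-mono-≤ (clashes⇒incidence s clashes) (blocked⇒length≤incidence s blocked))
            (≤-reflexive (sym (incidence-++ s F)))

  place : Seagull a b → List (Flock a b) → List (Flock a b)
  place s [] = []
  place s (F ∷ Fs) with all? (vertexDisjoint? s) F
  ... | yes _ = (s ∷ F) ∷ Fs
  ... | no _  = F ∷ place s Fs

  length-place : (s : Seagull a b) (Fs : List (Flock a b)) → length (place s Fs) ≡ length Fs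
  length-place s [] = refl
  length-place s (F ∷ Fs) with all? (vertexDisjoint? s) F
  ... | yes _ = refl
  ... | no _  = cong suc (length-place s Fs)

  place-IsFlock : (s : Seagull a b) {Fs : List (Flock a b)} → All IsFlock Fs → All IsFlock (place s Fs)
  place-IsFlock s [] = []
  place-IsFlock s {F ∷ _} (flock ∷ flocks) with all? (vertexDisjoint? s) F
  ... | yes disjoint = (disjoint ∷ flock) ∷ flocks
  ... | no _         = flock ∷ place-IsFlock s flocks

  place-SeagullIn : (G : BipGraph a b) {s : Seagull a b} → SeagullIn G s → {Fs : List (Flock a b)} →
    All (All (SeagullIn G)) Fs → All (All (SeagullIn G)) (place s Fs)
  place-SeagullIn G s∈G [] = []
  place-SeagullIn G {s} s∈G {F ∷ _} (F⊆G ∷ Fs⊆G) with all? (vertexDisjoint? s) F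
  ... | yes _ = (s∈G ∷ F⊆G) ∷ Fs⊆G
  ... | no _  = F⊆G ∷ place-SeagullIn G s∈G Fs⊆G

  blocked-or-placed : (s : Seagull a b) (Fs : List (Flock a b)) →
    All (Clashes s) Fs ⊎
    (∀ x y → multiplicity (concat (place s Fs)) x y ≡ edgeCount x y s + multiplicity (concat Fs) x y)
  blocked-or-placed s [] = inj₁ []
  blocked-or-placed s (F ∷ Fs) with all? (vertexDisjoint? s) F
  ... | yes _ = inj₂ (λ x y → refl)
  ... | no ¬fits with blocked-or-placed s Fs
  ...   | inj₁ blocked = inj₁ (¬All⇒Any¬ (vertexDisjoint? s) F ¬fits ∷ blocked)
  ...   | inj₂ placed  = inj₂ λ x y → begin
    multiplicity (F ++ concat (place s Fs)) x y
      ≡⟨ multiplicity-++ F ⟩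
    multiplicity F x y + multiplicity (concat (place s Fs)) x y
      ≡⟨ cong (multiplicity F x y +_) (placed x y) ⟩
    multiplicity F x y + (edgeCount x y s + multiplicity (concat Fs) x y)
      ≡⟨ x∙yz≈y∙xz +-commutativeSemigroup (multiplicity F x y) (edgeCount x y s) _ ⟩
    edgeCount x y s + (multiplicity F x y + multiplicity (concat Fs) x y)
      ≡⟨ cong (edgeCount x y s +_) (multiplicity-++ F) ⟨
    edgeCount x y s + multiplicity (F ++ concat Fs) x y ∎
    where open ≡-Reasoning

  module _ (G : BipGraph a b) where

    record GreedyState (Fs : List (Flock a b)) (L : List (Seagull a b)) : Set where
      field
        flocks  : All IsFlock Fs
        inG     : All (All (SeagullIn G)) Fs
        pending : All (SeagullIn G) L
        covers  : ∀ x y → multiplicity (concat Fs) x y + multiplicity L x y ≡ edges G x y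

    open GreedyState

    blocked⇒fewer-than-3Δ : {s : Seagull a b} {Fs : List (Flock a b)} {L : List (Seagull a b)} →
      GreedyState Fs (s ∷ L) → All (Clashes s) Fs → length Fs < 3 * Δ G
    blocked⇒fewer-than-3Δ {s} {Fs} {L} state blocked = begin-strict
      length Fs
        ≤⟨ blocked⇒length≤incidence s blocked ⟩
      incidence s (multiplicity (concat Fs))
        -- s meets itself, and its edges are still pending
        <⟨ m<m+n _ (clashes⇒incidence s {s ∷ L} (here (λ disjoint → proj₁ disjoint refl))) ⟩
      incidence s (multiplicity (concat Fs)) + incidence s (multiplicity (s ∷ L))
        ≡⟨ trans (incidence-cong s (λ x y → sym (covers state x y)))
                 (incidence-+ s (multiplicity (concat Fs)) (multiplicity (s ∷ L))) ⟨
      incidence s (edges G)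
        ≤⟨ incidence-edges≤3Δ G s ⟩
      3 * Δ G ∎
      where open ≤-Reasoning

    place-GreedyState : {s : Seagull a b} {Fs : List (Flock a b)} {L : List (Seagull a b)} →
      GreedyState Fs (s ∷ L) →
      (∀ x y → multiplicity (concat (place s Fs)) x y ≡ edgeCount x y s + multiplicity (concat Fs) x y) →
      GreedyState (place s Fs) L
    place-GreedyState {s} {Fs} {L} state placed = record
      { flocks  = place-IsFlock s (flocks state)
      ; inG     = place-SeagullIn G (All.head (pending state)) (inG state)
      ; pending = All.tail (pending state)
      ; covers  = λ x y → begin
          multiplicity (concat (place s Fs)) x y + multiplicity L x y
            ≡⟨ cong (_+ multiplicity L x y) (placed x y) ⟩
          (edgeCount x y s + multiplicity (concat Fs) x y) + multiplicity L x y
            ≡⟨ xy∙z≈y∙xz +-commutativeSemigroup (edgeCount x y s) _ _ ⟩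
          multiplicity (concat Fs) x y + multiplicity (s ∷ L) x y
            ≡⟨ covers state x y ⟩
          edges G x y ∎
      }
      where open ≡-Reasoning

    greedy : (L : List (Seagull a b)) (Fs : List (Flock a b)) → 3 * Δ G ≤ length Fs → GreedyState Fs L →
      Σ (List (Flock a b)) (λ Fs′ → Decomposition G Fs′ × length Fs′ ≡ length Fs)
    greedy [] Fs _ state = Fs , decomposition , refl
      where
      decomposition : Decomposition G Fs
      decomposition = record
        { flocks    = flocks state
        ; inG       = inG state
        ; exactOnce = λ x y xy∈G →
            trans (sym (+-identityʳ _)) (trans (covers state x y) (cong indicator xy∈G))
        }
    greedy (s ∷ L) Fs 3Δ≤|Fs| state with blocked-or-placed s Fs
    ... | inj₁ blocked = ⊥-elim (<⇒≱ (blocked⇒fewer-than-3Δ state blocked) 3Δ≤|Fs|)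
    ... | inj₂ placed
      with Fs′ , decomposition , |Fs′|≡|sFs| ← greedy L (place s Fs)
             (≤-trans 3Δ≤|Fs| (≤-reflexive (sym (length-place s Fs)))) (place-GreedyState state placed)
      = Fs′ , decomposition , trans |Fs′|≡|sFs| (length-place s Fs)

    initialState : (∀ c → 2 ∣ degB G c) → (n : ℕ) → GreedyState (replicate n []) (seagulls G)
    initialState even n = record
      { flocks  = replicate⁺ n []
      ; inG     = replicate⁺ n []
      ; pending = seagulls-SeagullIn G
      ; covers  = λ x y → trans (cong (_+ multiplicity (seagulls G) x y) (no-edges n))
                                (multiplicity-seagulls G even x y)
      }
      where
      no-edges : ∀ n {x y} → multiplicity (concat (replicate n [])) x y ≡ 0
      no-edges zero = refl
      no-edges (suc n) = no-edges n

proposition3p17 : (a b : ℕ) (G : BipGraph a b) →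
    (∀ (y : Fin b) → 2 ∣ degB G y) →
    Σ (List (Flock a b)) (λ Fs → Decomposition G Fs × length Fs ≤ 3 * Δ G)
proposition3p17 a b G even
  with Fs , decomposition , |Fs|≡3Δ ← greedy G (seagulls G) (replicate (3 * Δ G) [])
                                        (≤-reflexive (sym (length-replicate (3 * Δ G))))
                                        (initialState G even (3 * Δ G))
  = Fs , decomposition , ≤-reflexive (trans |Fs|≡3Δ (length-replicate (3 * Δ G)))
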